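{- Let $A$ be a real symmetric $5\times 5$ matrix and let $\sigma\in S_5$ be a permutation realizing the tropical determinant of $A$. Then there is a matrix $A'$ obtained from $A$ by a diagonal permutation (given by some $\pi\in S_5$) followed by a sequence of symmetric scalings, such that every entry of $A'$ is nonnegative and $A'_{\pi(i),\pi(\sigma(i))}=0$ for all $1\le i\le 5$.
   Context: For a real $n\times n$ matrix $A$, the tropical determinant is $\operatorname{tropdet}(A)=\min_{\sigma\in S_n}\sum_{i=1}^n A_{i,\sigma(i)}$, and $\sigma$ realizes the tropical determinant if it attains this minimum. A diagonal permutation of a symmetric matrix permutes its rows and its columns by the same permutation $\pi$ (so the new matrix $A'$ satisfies $A'_{\pi(i),\pi(j)}=A_{i,j}$). A symmetric scaling adds a real constant $c$ to every entry of row $i$ and to every entry of column $i$ (so the diagonal entry $A_{i,i}$ increases by $2c$). -}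

module Defs where

open import Data.Nat using (ℕ; zero; suc)
open import Data.Fin using (Fin; zero; suc; _≟_)
open import Data.Fin.Permutation using (Permutation′; _⟨$⟩ʳ_; _⟨$⟩ˡ_)
open import Data.List using (List; []; _∷_)
open import Data.Product using (Σ; ∃; _×_; _,_)
open import Relation.Nullary using (¬_; yes; no)
open import Relation.Binary.PropositionalEquality using (_≡_)
open import Relation.Binary.Structures using (IsTotalOrder)
open import Algebra.Structures using (IsCommutativeRing)

-- The real numbers, axiomatised as a (Dedekind-)complete ordered field.
-- Any model of this record is isomorphic to ℝ.
record RealNumbers : Set₁ where
  infixl 6 _+_
  infixl 7 _*_
  infix 4 _≤_
  field
    ℝ   : Set
    _+_ : ℝ → ℝ → ℝ
    _*_ : ℝ → ℝ → ℝ
    -_  : ℝ → ℝ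
    0ℝ  : ℝ
    1ℝ  : ℝ
    _≤_ : ℝ → ℝ → Set
    isCommutativeRing : IsCommutativeRing _≡_ _+_ _*_ -_ 0ℝ 1ℝ
    0≢1 : ¬ (0ℝ ≡ 1ℝ)
    inverse : ∀ x → ¬ (x ≡ 0ℝ) → Σ ℝ (λ y → x * y ≡ 1ℝ)
    isTotalOrder : IsTotalOrder _≡_ _≤_
    +-mono-≤ : ∀ x y z → x ≤ y → x + z ≤ y + z
    *-nonneg : ∀ x y → 0ℝ ≤ x → 0ℝ ≤ y → 0ℝ ≤ x * y
    complete : (P : ℝ → Set) → ∃ P → (∃ λ b → ∀ x → P x → x ≤ b) →
               ∃ λ s → (∀ x → P x → x ≤ s) × (∀ b → (∀ x → P x → x ≤ b) → s ≤ b)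

module _ (R : RealNumbers) where
  open RealNumbers R

  Matrix : ℕ → Set
  Matrix n = Fin n → Fin n → ℝ

  Symmetric : ∀ {n} → Matrix n → Set
  Symmetric A = ∀ i j → A i j ≡ A j i

  sumFin : ∀ n → (Fin n → ℝ) → ℝ
  sumFin zero f = 0ℝ
  sumFin (suc n) f = f zero + sumFin n (λ i → f (suc i))

  permWeight : ∀ {n} → Matrix n → Permutation′ n → ℝ
  permWeight {n} A σ = sumFin n (λ i → A i (σ ⟨$⟩ʳ i))

  RealizesTropDet : ∀ {n} → Matrix n → Permutation′ n → Set
  RealizesTropDet A σ = ∀ τ → permWeight A σ ≤ permWeight A τ

  -- diagonal permutation: A'_{π(i),π(j)} = A_{i,j}
  diagPerm : ∀ {n} → Permutation′ n → Matrix n → Matrix n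
  diagPerm π A k l = A (π ⟨$⟩ˡ k) (π ⟨$⟩ˡ l)

  indicator : ∀ {n} → Fin n → ℝ → Fin n → ℝ
  indicator i c k with k ≟ i
  ... | yes _ = c
  ... | no _ = 0ℝ

  symScale : ∀ {n} → Fin n → ℝ → Matrix n → Matrix n
  symScale i c A k l = A k l + indicator i c k + indicator i c l

  applyScalings : ∀ {n} → List (Fin n × ℝ) → Matrix n → Matrix n
  applyScalings [] A = A
  applyScalings ((i , c) ∷ ops) A = applyScalings ops (symScale i c A)

{-# OPTIONS --safe #-}
-- Take π to be the identity; it suffices to find w with A k l + w k + w l ≥ 0 and equality at (i , σ i).
-- Optimality of σ says that the reduced costs c i j = A i σ(j) − A i σ(i) give every permutation, hence
-- every simple cycle, nonnegative total cost.  So shortest-walk distances φ for c exist and satisfy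
-- φ i ≤ c i j + φ j, which yields dual variables u, v with A r k + u r + v k ≥ 0 and equality at k = σ r.
-- For symmetric A the reverse slacks at (σ i , i) are nonnegative and also sum to 0, hence vanish, and
-- w = (u + v) / 2 averages the two slack matrices.
module Submission where

open import Defs
open import Algebra.Bundles using (CommutativeRing)
import Algebra.Properties.CommutativeMonoid.Sum as CommutativeMonoidSum
import Algebra.Properties.Ring as RingProperties
import Algebra.Solver.CommutativeMonoid as CommutativeMonoidSolver
open import Data.Fin using (Fin; zero; suc; _≟_)
open import Data.Fin.Permutation
  using (Permutation′; _⟨$⟩ʳ_; _⟨$⟩ˡ_; _∘ₚ_; inverseˡ; inverseʳ; transpose) renaming (id to idₚ)
open import Data.Fin.Properties using (suc-injective; injective⇒≤)
open import Data.List using (List; []; _∷_; _++_; [_]; length; lookup; tabulate)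
import Data.List.Extrema as Extrema
import Data.List.Membership.DecPropositional as DecMembership
open import Data.List.Membership.Propositional using (_∈_; _∉_)
open import Data.List.Membership.Propositional.Properties using (∈-lookup; ∈-∃++)
open import Data.List.Properties using (length-++-≤ʳ)
open import Data.List.Relation.Unary.All as All using ([]; _∷_)
open import Data.List.Relation.Unary.All.Properties
  using (++⁻ˡ; ++⁻ʳ; tabulate⁺; tabulate⁻; All¬⇒¬Any; ¬Any⇒All¬)
open import Data.List.Relation.Unary.AllPairs using ([]; _∷_)
open import Data.List.Relation.Unary.Any using (here; there)
open import Data.List.Relation.Unary.Unique.Propositional using (Unique)
open import Data.Nat as ℕ using (ℕ; zero; suc; s≤s)
import Data.Nat.Properties as ℕP
open import Data.Product using (Σ; _×_; _,_; proj₁; proj₂)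
open import Data.Sum using (_⊎_; inj₁; inj₂)
open import Data.Vec.Functional using (updateAt)
open import Data.Vec.Functional.Properties using (updateAt-updates; updateAt-minimal)
open import Function using (_∘_)
open import Function.Definitions using (Injective)
open import Relation.Binary.Bundles using (TotalOrder)
open import Relation.Binary.PropositionalEquality hiding ([_])
open import Relation.Binary.Structures using (IsTotalOrder)
open import Relation.Nullary using (yes; no; contradiction)
open import Relation.Nullary.Decidable using (dec-true; dec-false)
open ≡-Reasoning

module Reals (R : RealNumbers) where
  open RealNumbers R public hiding (+-mono-≤)

  commutativeRing : CommutativeRing _ _
  commutativeRing = record { isCommutativeRing = isCommutativeRing }

  open CommutativeRing commutativeRing public
    using (+-assoc; +-comm; +-identityˡ; +-identityʳ; -‿inverseˡ; -‿inverseʳ;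
           *-identityʳ; *-assoc; *-comm; distribˡ; distribʳ; zeroˡ; +-commutativeMonoid)
  open RingProperties (CommutativeRing.ring commutativeRing) public
    using (-‿distribˡ-*; -‿distribʳ-*; -‿involutive; -‿+-comm; -0#≈0#; +-cancelʳ)
  open IsTotalOrder isTotalOrder public
    using (total; antisym) renaming (refl to ≤-refl; trans to ≤-trans)
  open CommutativeMonoidSolver +-commutativeMonoid public
    using (_⊕_; _⊜_) renaming (solve to +-solve)
  open CommutativeMonoidSum +-commutativeMonoid public
    using (sum; sum-cong-≗; ∑-distrib-+; sum-permute; sum-replicate-zero)

  totalOrder : TotalOrder _ _ _
  totalOrder = record { isTotalOrder = isTotalOrder }

  +-monoˡ-≤ : ∀ {x y} z → x ≤ y → x + z ≤ y + z
  +-monoˡ-≤ z x≤y = RealNumbers.+-mono-≤ R _ _ z x≤y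

  +-monoʳ-≤ : ∀ {x y} z → x ≤ y → z + x ≤ z + y
  +-monoʳ-≤ {x} {y} z x≤y = subst₂ _≤_ (+-comm x z) (+-comm y z) (+-monoˡ-≤ z x≤y)

  +-mono-≤ : ∀ {x y z w} → x ≤ y → z ≤ w → x + z ≤ y + w
  +-mono-≤ {y = y} x≤y z≤w = ≤-trans (+-monoˡ-≤ _ x≤y) (+-monoʳ-≤ y z≤w)

  +-nonneg : ∀ {x y} → 0ℝ ≤ x → 0ℝ ≤ y → 0ℝ ≤ x + y
  +-nonneg 0≤x 0≤y = subst (_≤ _) (+-identityʳ 0ℝ) (+-mono-≤ 0≤x 0≤y)

  x≤x+y : ∀ x {y} → 0ℝ ≤ y → x ≤ x + y
  x≤x+y x 0≤y = subst (_≤ x + _) (+-identityʳ x) (+-monoʳ-≤ x 0≤y)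

  x≤y⇒0≤y-x : ∀ {x y} → x ≤ y → 0ℝ ≤ y + - x
  x≤y⇒0≤y-x {x} {y} x≤y = subst (_≤ y + - x) (-‿inverseʳ x) (+-monoˡ-≤ (- x) x≤y)

  +-nonneg-≡0 : ∀ {x y} → 0ℝ ≤ x → 0ℝ ≤ y → x + y ≡ 0ℝ → x ≡ 0ℝ × y ≡ 0ℝ
  +-nonneg-≡0 {x} {y} 0≤x 0≤y x+y≡0 =
    antisym (subst (x ≤_) x+y≡0 (x≤x+y x 0≤y)) 0≤x ,
    antisym (subst (y ≤_) (trans (+-comm y x) x+y≡0) (x≤x+y y 0≤x)) 0≤y

  x*x-nonneg : ∀ x → 0ℝ ≤ x * x
  x*x-nonneg x with total 0ℝ x
  ... | inj₁ 0≤x = *-nonneg x x 0≤x 0≤x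
  ... | inj₂ x≤0 = subst (0ℝ ≤_) -x*-x≡x*x (*-nonneg (- x) (- x) 0≤-x 0≤-x)
    where
    0≤-x : 0ℝ ≤ - x
    0≤-x = subst₂ _≤_ (-‿inverseʳ x) (+-identityˡ (- x)) (+-monoˡ-≤ (- x) x≤0)
    -x*-x≡x*x : - x * - x ≡ x * x
    -x*-x≡x*x = trans (sym (-‿distribˡ-* x (- x)))
                  (trans (cong -_ (sym (-‿distribʳ-* x x))) (-‿involutive (x * x)))

  0≤1 : 0ℝ ≤ 1ℝ
  0≤1 = subst (0ℝ ≤_) (*-identityʳ 1ℝ) (x*x-nonneg 1ℝ)

  2ℝ : ℝ
  2ℝ = 1ℝ + 1ℝ

  0≤2 : 0ℝ ≤ 2ℝ
  0≤2 = +-nonneg 0≤1 0≤1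

  2≢0 : 2ℝ ≢ 0ℝ
  2≢0 2≡0 = 0≢1 (antisym 0≤1 (subst (1ℝ ≤_) 2≡0 (x≤x+y 1ℝ 0≤1)))

  ½ : ℝ
  ½ = proj₁ (inverse 2ℝ 2≢0)

  2*½≡1 : 2ℝ * ½ ≡ 1ℝ
  2*½≡1 = proj₂ (inverse 2ℝ 2≢0)

  0≤½ : 0ℝ ≤ ½
  0≤½ = subst (0ℝ ≤_) ½*½*2≡½ (*-nonneg _ _ (x*x-nonneg ½) 0≤2)
    where
    ½*½*2≡½ : ½ * ½ * 2ℝ ≡ ½
    ½*½*2≡½ = begin
      ½ * ½ * 2ℝ    ≡⟨ *-assoc ½ ½ 2ℝ ⟩
      ½ * (½ * 2ℝ)  ≡⟨ cong (½ *_) (trans (*-comm ½ 2ℝ) 2*½≡1) ⟩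
      ½ * 1ℝ        ≡⟨ *-identityʳ ½ ⟩
      ½             ∎

  [x+x]*½≡x : ∀ x → (x + x) * ½ ≡ x
  [x+x]*½≡x x = begin
    (x + x) * ½              ≡⟨ cong (λ y → (y + y) * ½) (sym (*-identityʳ x)) ⟩
    (x * 1ℝ + x * 1ℝ) * ½    ≡⟨ cong (_* ½) (sym (distribˡ x 1ℝ 1ℝ)) ⟩
    x * 2ℝ * ½               ≡⟨ *-assoc x 2ℝ ½ ⟩
    x * (2ℝ * ½)             ≡⟨ cong (x *_) 2*½≡1 ⟩
    x * 1ℝ                   ≡⟨ *-identityʳ x ⟩
    x                        ∎

  x+[y+z]*½+[y′+z′]*½ : ∀ x y z y′ z′ →
    x + (y + z) * ½ + (y′ + z′) * ½ ≡ ((x + y + z′) + (x + y′ + z)) * ½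
  x+[y+z]*½+[y′+z′]*½ x y z y′ z′ = begin
    x + (y + z) * ½ + (y′ + z′) * ½
      ≡⟨ cong (λ a → a + (y + z) * ½ + (y′ + z′) * ½) ([x+x]*½≡x x) ⟨
    (x + x) * ½ + (y + z) * ½ + (y′ + z′) * ½
      ≡⟨ cong (_+ (y′ + z′) * ½) (distribʳ ½ _ _) ⟨
    ((x + x) + (y + z)) * ½ + (y′ + z′) * ½
      ≡⟨ distribʳ ½ _ _ ⟨
    ((x + x) + (y + z) + (y′ + z′)) * ½
      ≡⟨ cong (_* ½) (+-solve 5 (λ a b c b′ c′ →
           ((a ⊕ a) ⊕ (b ⊕ c)) ⊕ (b′ ⊕ c′) ⊜ ((a ⊕ b) ⊕ c′) ⊕ ((a ⊕ b′) ⊕ c)) refl x y z y′ z′) ⟩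
    ((x + y + z′) + (x + y′ + z)) * ½                ∎

  sumFin≡sum : ∀ n (f : Fin n → ℝ) → sumFin R n f ≡ sum f
  sumFin≡sum zero    f = refl
  sumFin≡sum (suc n) f = cong (f zero +_) (sumFin≡sum n (f ∘ suc))

  sum-neg : ∀ {n} (f : Fin n → ℝ) → sum (λ i → - f i) ≡ - sum f
  sum-neg {zero}  f = sym -0#≈0#
  sum-neg {suc n} f = trans (cong (- f zero +_) (sum-neg (f ∘ suc))) (-‿+-comm _ _)

  sum-nonneg : ∀ {n} {f : Fin n → ℝ} → (∀ i → 0ℝ ≤ f i) → 0ℝ ≤ sum f
  sum-nonneg {zero}  0≤f = ≤-refl
  sum-nonneg {suc n} 0≤f = +-nonneg (0≤f zero) (sum-nonneg (0≤f ∘ suc))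

  sum-nonneg-≡0 : ∀ {n} {f : Fin n → ℝ} → (∀ i → 0ℝ ≤ f i) → sum f ≡ 0ℝ → ∀ i → f i ≡ 0ℝ
  sum-nonneg-≡0 {suc n} 0≤f sum≡0 with +-nonneg-≡0 (0≤f zero) (sum-nonneg (0≤f ∘ suc)) sum≡0
  ... | head≡0 , tail≡0 = λ where
    zero    → head≡0
    (suc i) → sum-nonneg-≡0 (0≤f ∘ suc) tail≡0 i

  sum-distrib₃ : ∀ {n} (f g h : Fin n → ℝ) → sum (λ i → f i + g i + h i) ≡ sum f + sum g + sum h
  sum-distrib₃ f g h = trans (∑-distrib-+ (λ i → f i + g i) h) (cong (_+ sum h) (∑-distrib-+ f g))

  sum-update : ∀ {n} {f g : Fin n → ℝ} p → (∀ x → x ≢ p → g x ≡ f x) → sum g + f p ≡ sum f + g p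
  sum-update {suc n} {f} {g} zero g≡f =
    trans (cong (λ s → g zero + s + f zero) (sum-cong-≗ (λ x → g≡f (suc x) λ ())))
          (+-solve 3 (λ a b s → (a ⊕ s) ⊕ b ⊜ (b ⊕ s) ⊕ a) refl (g zero) (f zero) _)
  sum-update {suc n} {f} {g} (suc p) g≡f = begin
    g zero + sum (g ∘ suc) + f (suc p)    ≡⟨ +-assoc _ _ _ ⟩
    g zero + (sum (g ∘ suc) + f (suc p))  ≡⟨ cong₂ _+_ (g≡f zero λ ()) tail-update ⟩
    f zero + (sum (f ∘ suc) + g (suc p))  ≡⟨ +-assoc _ _ _ ⟨
    f zero + sum (f ∘ suc) + g (suc p)    ∎
    where
    tail-update : sum (g ∘ suc) + f (suc p) ≡ sum (f ∘ suc) + g (suc p)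
    tail-update = sum-update p (λ x x≢p → g≡f (suc x) (x≢p ∘ suc-injective))

  sum-update₂ : ∀ {n} {f g : Fin n → ℝ} {p q} → p ≢ q → (∀ x → x ≢ p → x ≢ q → g x ≡ f x) →
                sum g + f p + f q ≡ sum f + g p + g q
  sum-update₂ {f = f} {g} {p} {q} p≢q g≡f = begin
    sum g + f p + f q  ≡⟨ +-solve 3 (λ s a b → (s ⊕ a) ⊕ b ⊜ (s ⊕ b) ⊕ a) refl _ _ _ ⟩
    sum g + f q + f p  ≡⟨ cong (λ y → sum g + y + f p) (sym hq≡fq) ⟩
    sum g + h q + f p  ≡⟨ cong (_+ f p) (sum-update q g≡h) ⟩
    sum h + g q + f p  ≡⟨ +-solve 3 (λ s a b → (s ⊕ a) ⊕ b ⊜ (s ⊕ b) ⊕ a) refl _ _ _ ⟩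
    sum h + f p + g q  ≡⟨ cong (_+ g q) (sum-update p h≡f) ⟩
    sum f + h p + g q  ≡⟨ cong (λ y → sum f + y + g q) (updateAt-minimal p q g p≢q) ⟩
    sum f + g p + g q  ∎
    where
    h : Fin _ → ℝ
    h = updateAt g q (λ _ → f q)
    hq≡fq : h q ≡ f q
    hq≡fq = updateAt-updates q g
    g≡h : ∀ x → x ≢ q → g x ≡ h x
    g≡h x x≢q = sym (updateAt-minimal x q g x≢q)
    h≡f : ∀ x → x ≢ p → h x ≡ f x
    h≡f x x≢p with x ≟ q
    ... | yes refl = hq≡fq
    ... | no x≢q   = trans (updateAt-minimal x q g x≢q) (g≡f x x≢p x≢q)

  sum-single : ∀ {n} {f : Fin n → ℝ} p → (∀ x → x ≢ p → f x ≡ 0ℝ) → sum f ≡ f p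
  sum-single {n} {f} p f≡0 = begin
    sum f                     ≡⟨ +-identityʳ (sum f) ⟨
    sum f + 0ℝ                ≡⟨ sum-update {f = λ _ → 0ℝ} p f≡0 ⟩
    sum {n} (λ _ → 0ℝ) + f p  ≡⟨ cong (_+ f p) (sum-replicate-zero n) ⟩
    0ℝ + f p                  ≡⟨ +-identityˡ (f p) ⟩
    f p                       ∎

transpose-matchˡ : ∀ {n} (i j : Fin n) → transpose i j ⟨$⟩ʳ i ≡ j
transpose-matchˡ i j rewrite dec-true (i ≟ i) refl = refl

transpose-matchʳ : ∀ {n} (i j : Fin n) → transpose i j ⟨$⟩ʳ j ≡ i
transpose-matchʳ i j with j ≟ i
... | yes refl = refl
... | no _ rewrite dec-true (j ≟ j) refl = refl

transpose-mismatch : ∀ {n} {i j k : Fin n} → k ≢ i → k ≢ j → transpose i j ⟨$⟩ʳ k ≡ k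
transpose-mismatch {i = i} {j} {k} k≢i k≢j
  rewrite dec-false (k ≟ i) k≢i | dec-false (k ≟ j) k≢j = refl

⟨$⟩ʳ-injective : ∀ {n} (ρ : Permutation′ n) {x y} → ρ ⟨$⟩ʳ x ≡ ρ ⟨$⟩ʳ y → x ≡ y
⟨$⟩ʳ-injective ρ ρx≡ρy = trans (sym (inverseˡ ρ)) (trans (cong (ρ ⟨$⟩ˡ_) ρx≡ρy) (inverseˡ ρ))

lookup-injective : ∀ {a} {A : Set a} {xs : List A} → Unique xs → Injective _≡_ _≡_ (lookup xs)
lookup-injective (_ ∷ _)  {zero}  {zero}  _   = refl
lookup-injective (x≢ ∷ _) {zero}  {suc j} x≡y = contradiction x≡y (All.lookup x≢ (∈-lookup j))
lookup-injective (x≢ ∷ _) {suc i} {zero}  y≡x = contradiction (sym y≡x) (All.lookup x≢ (∈-lookup i))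
lookup-injective (_ ∷ u)  {suc i} {suc j} eq  = cong suc (lookup-injective u eq)

unique-length : ∀ {n} {xs : List (Fin n)} → Unique xs → length xs ℕ.≤ n
unique-length u = injective⇒≤ (lookup-injective u)

unique-loop : ∀ {a} {A : Set a} (M : List A) {x N} → Unique (M ++ x ∷ N) → Unique (x ∷ M)
unique-loop []      _         = [] ∷ []
unique-loop (y ∷ M) (y≢ ∷ u) with unique-loop M u
... | x≢M ∷ uM = (≢-sym (All.head (++⁻ʳ M y≢)) ∷ x≢M) ∷ (++⁻ˡ M y≢ ∷ uM)

module Walks (R : RealNumbers) {n : ℕ} (c : Fin n → Fin n → RealNumbers.ℝ R) where
  open Reals R
  open Extrema totalOrder using (argmin; argmin-all; f[argmin]≤f[⊤]; f[argmin]≤f[xs])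
  open DecMembership (_≟_ {n = n}) using (_∈?_)

  weight : List (Fin n) → ℝ
  weight (x ∷ y ∷ ys) = c x y + weight (y ∷ ys)
  weight _            = 0ℝ

  final : Fin n → List (Fin n) → Fin n
  final x []       = x
  final x (y ∷ ys) = final y ys

  final-∈ : ∀ x ys → final x ys ∈ x ∷ ys
  final-∈ x []       = here refl
  final-∈ x (y ∷ ys) = there (final-∈ y ys)

  weight-snoc : ∀ x ys z → weight (x ∷ ys ++ [ z ]) ≡ weight (x ∷ ys) + c (final x ys) z
  weight-snoc x []       z = trans (+-identityʳ _) (sym (+-identityˡ _))
  weight-snoc x (y ∷ ys) z = trans (cong (c x y +_) (weight-snoc y ys z)) (sym (+-assoc _ _ _))

  weight-++ : ∀ xs b ys → weight (xs ++ b ∷ ys) ≡ weight (xs ++ [ b ]) + weight (b ∷ ys)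
  weight-++ []           b ys = sym (+-identityˡ _)
  weight-++ (x ∷ [])     b ys = cong (_+ weight (b ∷ ys)) (sym (+-identityʳ (c x b)))
  weight-++ (x ∷ y ∷ xs) b ys = trans (cong (c x y +_) (weight-++ (y ∷ xs) b ys)) (sym (+-assoc _ _ _))

  weight-cut : ∀ P b M N → weight (P ++ b ∷ M ++ b ∷ N) ≡ weight (P ++ b ∷ N) + weight (b ∷ M ++ [ b ])
  weight-cut P b M N = begin
    weight (P ++ b ∷ M ++ b ∷ N)
      ≡⟨ weight-++ P b (M ++ b ∷ N) ⟩
    weight (P ++ [ b ]) + weight (b ∷ M ++ b ∷ N)
      ≡⟨ cong (weight (P ++ [ b ]) +_) (weight-++ (b ∷ M) b N) ⟩
    weight (P ++ [ b ]) + (weight (b ∷ M ++ [ b ]) + weight (b ∷ N))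
      ≡⟨ +-solve 3 (λ p m t → p ⊕ (m ⊕ t) ⊜ (p ⊕ t) ⊕ m) refl _ _ _ ⟩
    weight (P ++ [ b ]) + weight (b ∷ N) + weight (b ∷ M ++ [ b ])
      ≡⟨ cong (_+ weight (b ∷ M ++ [ b ])) (weight-++ P b N) ⟨
    weight (P ++ b ∷ N) + weight (b ∷ M ++ [ b ]) ∎

  length-cut : ∀ P (b : Fin n) M N → length (P ++ b ∷ N) ℕ.< length (P ++ b ∷ M ++ b ∷ N)
  length-cut []      b M N = s≤s (length-++-≤ʳ (b ∷ N) {M})
  length-cut (x ∷ P) b M N = s≤s (length-cut P b M N)

  SimpleCycleSplit : List (Fin n) → Set
  SimpleCycleSplit xs = Σ (List (Fin n)) λ P → Σ (Fin n) λ b → Σ (List (Fin n)) λ M →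
    Σ (List (Fin n)) λ N → xs ≡ P ++ b ∷ M ++ b ∷ N × Unique (b ∷ M)

  unique⊎simpleCycleSplit : ∀ xs → Unique xs ⊎ SimpleCycleSplit xs
  unique⊎simpleCycleSplit []       = inj₁ []
  unique⊎simpleCycleSplit (x ∷ xs) with unique⊎simpleCycleSplit xs
  ... | inj₂ (P , b , M , N , refl , u) = inj₂ (x ∷ P , b , M , N , refl , u)
  ... | inj₁ u with x ∈? xs
  ...   | no x∉xs = inj₁ (¬Any⇒All¬ xs x∉xs ∷ u)
  ...   | yes x∈xs with M , N , refl ← ∈-∃++ x∈xs = inj₂ ([] , x , M , N , refl , unique-loop M u)

  cost : Permutation′ n → ℝ
  cost ρ = sum (λ i → c i (ρ ⟨$⟩ʳ i))

  -- cycle k ks maps k to the first vertex of ks, each vertex of ks to the next, and the last back to k.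
  cycle : Fin n → List (Fin n) → Permutation′ n
  cycle k []        = idₚ
  cycle k (k′ ∷ ks) = cycle k′ ks ∘ₚ transpose k k′

  cycle-fixes : ∀ k ks {x} → x ∉ k ∷ ks → cycle k ks ⟨$⟩ʳ x ≡ x
  cycle-fixes k []        x∉ = refl
  cycle-fixes k (k′ ∷ ks) x∉ = trans (cong (transpose k k′ ⟨$⟩ʳ_) (cycle-fixes k′ ks (x∉ ∘ there)))
                                     (transpose-mismatch (x∉ ∘ here) (x∉ ∘ there ∘ here))

  cycle-closes : ∀ k ks → cycle k ks ⟨$⟩ʳ final k ks ≡ k
  cycle-closes k []        = refl
  cycle-closes k (k′ ∷ ks) = trans (cong (transpose k k′ ⟨$⟩ʳ_) (cycle-closes k′ ks))
                                   (transpose-matchʳ k k′)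

  module _ (c-diag : ∀ i → c i i ≡ 0ℝ) where

    cost-∘ₚ-transpose : ∀ ρ {a b L} → a ≢ L → ρ ⟨$⟩ʳ a ≡ a → ρ ⟨$⟩ʳ L ≡ b →
                        cost (ρ ∘ₚ transpose a b) + c L b ≡ cost ρ + c a b + c L a
    cost-∘ₚ-transpose ρ {a} {b} {L} a≢L ρa≡a ρL≡b = begin
      sum g + c L b       ≡⟨ cong (_+ c L b) (+-identityʳ (sum g)) ⟨
      sum g + 0ℝ + c L b  ≡⟨ cong₂ (λ x y → sum g + x + y) fa≡0 fL≡cLb ⟨
      sum g + f a + f L   ≡⟨ sum-update₂ a≢L g≡f ⟩
      sum f + g a + g L   ≡⟨ cong₂ (λ x y → sum f + x + y) ga≡cab gL≡cLa ⟩
      sum f + c a b + c L a ∎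
      where
      τ = transpose a b
      f g : Fin n → ℝ
      f i = c i (ρ ⟨$⟩ʳ i)
      g i = c i (τ ⟨$⟩ʳ (ρ ⟨$⟩ʳ i))
      g≡f : ∀ x → x ≢ a → x ≢ L → g x ≡ f x
      g≡f x x≢a x≢L = cong (c x) (transpose-mismatch
        (x≢a ∘ ⟨$⟩ʳ-injective ρ ∘ (λ ρx≡a → trans ρx≡a (sym ρa≡a)))
        (x≢L ∘ ⟨$⟩ʳ-injective ρ ∘ (λ ρx≡b → trans ρx≡b (sym ρL≡b))))
      fa≡0 : f a ≡ 0ℝ
      fa≡0 = trans (cong (c a) ρa≡a) (c-diag a)
      fL≡cLb : f L ≡ c L b
      fL≡cLb = cong (c L) ρL≡b
      ga≡cab : g a ≡ c a b
      ga≡cab = cong (c a) (trans (cong (τ ⟨$⟩ʳ_) ρa≡a) (transpose-matchˡ a b))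
      gL≡cLa : g L ≡ c L a
      gL≡cLa = cong (c L) (trans (cong (τ ⟨$⟩ʳ_) ρL≡b) (transpose-matchʳ a b))

    cost-cycle : ∀ k ks → Unique (k ∷ ks) → cost (cycle k ks) ≡ weight (k ∷ ks ++ [ k ])
    cost-cycle k [] _ = begin
      sum (λ i → c i i)   ≡⟨ sum-cong-≗ c-diag ⟩
      sum {n} (λ _ → 0ℝ)  ≡⟨ sum-replicate-zero n ⟩
      0ℝ                  ≡⟨ trans (+-identityʳ (c k k)) (c-diag k) ⟨
      c k k + 0ℝ          ∎
    cost-cycle k₀ (k₁ ∷ ks) (k₀≢ ∷ u) = +-cancelʳ (c L k₁) _ _ (begin
      cost (cycle k₁ ks ∘ₚ transpose k₀ k₁) + c L k₁
        ≡⟨ cost-∘ₚ-transpose (cycle k₁ ks) k₀≢L (cycle-fixes k₁ ks k₀∉) (cycle-closes k₁ ks) ⟩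
      cost (cycle k₁ ks) + c k₀ k₁ + c L k₀
        ≡⟨ cong (λ x → x + c k₀ k₁ + c L k₀) (trans (cost-cycle k₁ ks u) (weight-snoc k₁ ks k₁)) ⟩
      W + c L k₁ + c k₀ k₁ + c L k₀
        ≡⟨ +-solve 4 (λ w a b d → ((w ⊕ a) ⊕ b) ⊕ d ⊜ (b ⊕ (w ⊕ d)) ⊕ a) refl _ _ _ _ ⟩
      c k₀ k₁ + (W + c L k₀) + c L k₁
        ≡⟨ cong (λ x → c k₀ k₁ + x + c L k₁) (weight-snoc k₁ ks k₀) ⟨
      c k₀ k₁ + weight (k₁ ∷ ks ++ [ k₀ ]) + c L k₁ ∎)
      where
      L = final k₁ ks
      W = weight (k₁ ∷ ks)
      k₀∉ : k₀ ∉ k₁ ∷ ks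
      k₀∉ = All¬⇒¬Any k₀≢
      k₀≢L : k₀ ≢ L
      k₀≢L k₀≡L = k₀∉ (subst (_∈ k₁ ∷ ks) (sym k₀≡L) (final-∈ k₁ ks))

  -- Bellman–Ford: i ∷ shortest t i is a cheapest walk from i with at most t steps.
  shortest : ℕ → Fin n → List (Fin n)
  candidates : ℕ → List (List (Fin n))
  shortest zero    i = []
  shortest (suc t) i = argmin (λ zs → weight (i ∷ zs)) (shortest t i) (candidates t)

  candidates t = tabulate (λ j → j ∷ shortest t j)

  shortest-length : ∀ t i → length (shortest t i) ℕ.≤ t
  shortest-length zero    i = ℕ.z≤n
  shortest-length (suc t) i = argmin-all _ {P = λ zs → length zs ℕ.≤ suc t}
    (ℕP.m≤n⇒m≤1+n (shortest-length t i)) (tabulate⁺ λ j → s≤s (shortest-length t j))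

  shortest-minimal : ∀ t i zs → length zs ℕ.≤ t → weight (i ∷ shortest t i) ≤ weight (i ∷ zs)
  shortest-minimal zero    i []       _         = ≤-refl
  shortest-minimal (suc t) i []       _         = ≤-trans
    (f[argmin]≤f[⊤] {f = λ zs → weight (i ∷ zs)} (shortest t i) (candidates t))
    (shortest-minimal t i [] ℕ.z≤n)
  shortest-minimal (suc t) i (j ∷ zs) (s≤s |zs|≤t) = ≤-trans
    (tabulate⁻ (f[argmin]≤f[xs] {f = λ zs → weight (i ∷ zs)} (shortest t i) (candidates t)) j)
    (+-monoʳ-≤ (c i j) (shortest-minimal t j zs |zs|≤t))

  module _ (c-diag : ∀ i → c i i ≡ 0ℝ) (cost-nonneg : ∀ ρ → 0ℝ ≤ cost ρ) where

    simpleCycle-nonneg : ∀ b M → Unique (b ∷ M) → 0ℝ ≤ weight (b ∷ M ++ [ b ])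
    simpleCycle-nonneg b M u = subst (0ℝ ≤_) (cost-cycle c-diag b M u) (cost-nonneg (cycle b M))

    cut-≤ : ∀ P b M N → Unique (b ∷ M) → weight (P ++ b ∷ N) ≤ weight (P ++ b ∷ M ++ b ∷ N)
    cut-≤ P b M N u = subst (weight (P ++ b ∷ N) ≤_) (sym (weight-cut P b M N))
                            (x≤x+y _ (simpleCycle-nonneg b M u))

    shortcut : ∀ x ys → SimpleCycleSplit (x ∷ ys) →
               Σ (List (Fin n)) λ zs → length zs ℕ.< length ys × weight (x ∷ zs) ≤ weight (x ∷ ys)
    shortcut x ys ([] , b , M , N , refl , u) =
      N , ℕ.s<s⁻¹ (length-cut [] b M N) , cut-≤ [] b M N u
    shortcut x ys (_ ∷ P , b , M , N , refl , u) =
      P ++ b ∷ N , ℕ.s<s⁻¹ (length-cut (x ∷ P) b M N) , cut-≤ (x ∷ P) b M N u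

    potential : Fin n → ℝ
    potential i = weight (i ∷ shortest n i)

    -- A simple walk has at most n vertices; from any other one a nonnegative simple cycle can be cut out.
    potential-triangle : ∀ i j → potential i ≤ c i j + potential j
    potential-triangle i j with unique⊎simpleCycleSplit (i ∷ j ∷ shortest n j)
    ... | inj₁ u = shortest-minimal n i (j ∷ shortest n j) (ℕP.<⇒≤ (unique-length u))
    ... | inj₂ split with zs , shorter , lighter ← shortcut i (j ∷ shortest n j) split = ≤-trans
      (shortest-minimal n i zs (ℕ.s≤s⁻¹ (ℕP.≤-trans shorter (s≤s (shortest-length n j)))))
      lighter

module _ (R : RealNumbers) where
  open Reals R

  reducedCost : ∀ {n} → Matrix R n → Permutation′ n → Fin n → Fin n → ℝ
  reducedCost A σ i j = A i (σ ⟨$⟩ʳ j) + - A i (σ ⟨$⟩ʳ i)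

  reducedCost-diag : ∀ {n} (A : Matrix R n) σ i → reducedCost A σ i i ≡ 0ℝ
  reducedCost-diag A σ i = -‿inverseʳ _

  cost-reducedCost : ∀ {n} (A : Matrix R n) σ ρ →
    Walks.cost R (reducedCost A σ) ρ ≡ permWeight R A (ρ ∘ₚ σ) + - permWeight R A σ
  cost-reducedCost {n} A σ ρ = begin
    sum (λ i → A i (σ ⟨$⟩ʳ (ρ ⟨$⟩ʳ i)) + - Aσ i)
      ≡⟨ ∑-distrib-+ (λ i → A i (σ ⟨$⟩ʳ (ρ ⟨$⟩ʳ i))) (λ i → - Aσ i) ⟩
    sum (λ i → A i (σ ⟨$⟩ʳ (ρ ⟨$⟩ʳ i))) + sum (λ i → - Aσ i)
      ≡⟨ cong₂ _+_ (sumFin≡sum n _) (trans (cong -_ (sumFin≡sum n Aσ)) (sym (sum-neg Aσ))) ⟨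
    permWeight R A (ρ ∘ₚ σ) + - permWeight R A σ ∎
    where
    Aσ : Fin n → ℝ
    Aσ i = A i (σ ⟨$⟩ʳ i)

  record IsAssignmentDual {n} (A : Matrix R n) (σ : Permutation′ n) (u v : Fin n → ℝ) : Set where
    constructor isAssignmentDual
    field
      slack-nonneg : ∀ r k → 0ℝ ≤ A r k + u r + v k
      slack-tight  : ∀ i → A i (σ ⟨$⟩ʳ i) + u i + v (σ ⟨$⟩ʳ i) ≡ 0ℝ

  assignment-dual : ∀ {n} (A : Matrix R n) σ → RealizesTropDet R A σ →
                    Σ (Fin n → ℝ) λ u → Σ (Fin n → ℝ) λ v → IsAssignmentDual A σ u v
  assignment-dual {n} A σ σ-optimal = u , v , isAssignmentDual slack-nonneg slack-tight
    where
    c = reducedCost A σ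
    open Walks R c using (cost; potential; potential-triangle)
    c-diag : ∀ i → c i i ≡ 0ℝ
    c-diag = reducedCost-diag A σ
    cost-nonneg : ∀ ρ → 0ℝ ≤ cost ρ
    cost-nonneg ρ = subst (0ℝ ≤_) (sym (cost-reducedCost A σ ρ)) (x≤y⇒0≤y-x (σ-optimal (ρ ∘ₚ σ)))
    φ : Fin n → ℝ
    φ = potential c-diag cost-nonneg
    u v : Fin n → ℝ
    u i = - A i (σ ⟨$⟩ʳ i) + - φ i
    v k = φ (σ ⟨$⟩ˡ k)
    slack-nonneg : ∀ r k → 0ℝ ≤ A r k + u r + v k
    slack-nonneg r k = subst (0ℝ ≤_) (sym slack≡)
                             (x≤y⇒0≤y-x (potential-triangle c-diag cost-nonneg r j))
      where
      j = σ ⟨$⟩ˡ k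
      slack≡ : A r k + u r + v k ≡ c r j + φ j + - φ r
      slack≡ = trans (cong (λ k′ → A r k′ + u r + v k) (sym (inverseʳ σ)))
        (+-solve 4 (λ a b p q → (a ⊕ (b ⊕ p)) ⊕ q ⊜ ((a ⊕ b) ⊕ q) ⊕ p) refl _ _ _ _)
    slack-tight : ∀ i → A i (σ ⟨$⟩ʳ i) + u i + v (σ ⟨$⟩ʳ i) ≡ 0ℝ
    slack-tight i = begin
      Aσi + u i + φ (σ ⟨$⟩ˡ (σ ⟨$⟩ʳ i))  ≡⟨ cong (λ x → Aσi + u i + φ x) (inverseˡ σ) ⟩
      Aσi + (- Aσi + - φ i) + φ i
        ≡⟨ +-solve 4 (λ a b p q → (a ⊕ (b ⊕ p)) ⊕ q ⊜ (a ⊕ b) ⊕ (p ⊕ q)) refl _ _ _ _ ⟩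
      (Aσi + - Aσi) + (- φ i + φ i)      ≡⟨ cong₂ _+_ (-‿inverseʳ Aσi) (-‿inverseˡ (φ i)) ⟩
      0ℝ + 0ℝ                            ≡⟨ +-identityʳ 0ℝ ⟩
      0ℝ                                 ∎
      where
      Aσi = A i (σ ⟨$⟩ʳ i)

  -- Symmetry of A and reindexing by σ turn the sum of the reverse slacks into that of the tight ones.
  reverse-slack-tight : ∀ {n} (A : Matrix R n) {σ u v} → Symmetric R A → IsAssignmentDual A σ u v →
                        ∀ i → A (σ ⟨$⟩ʳ i) i + u (σ ⟨$⟩ʳ i) + v i ≡ 0ℝ
  reverse-slack-tight {n} A {σ} {u} {v} A-sym (isAssignmentDual slack-nonneg slack-tight) =
    sum-nonneg-≡0 (λ i → slack-nonneg _ i) (begin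
      sum (λ i → A (σ ⟨$⟩ʳ i) i + u (σ ⟨$⟩ʳ i) + v i)
        ≡⟨ sum-distrib₃ (λ i → A (σ ⟨$⟩ʳ i) i) (u ∘ (σ ⟨$⟩ʳ_)) v ⟩
      sum (λ i → A (σ ⟨$⟩ʳ i) i) + sum (u ∘ (σ ⟨$⟩ʳ_)) + sum v
        ≡⟨ cong₂ _+_ (cong₂ _+_ (sum-cong-≗ (λ i → A-sym _ i)) (sym (sum-permute u σ)))
                     (sum-permute v σ) ⟩
      sum (λ i → A i (σ ⟨$⟩ʳ i)) + sum u + sum (v ∘ (σ ⟨$⟩ʳ_))
        ≡⟨ sum-distrib₃ (λ i → A i (σ ⟨$⟩ʳ i)) u (v ∘ (σ ⟨$⟩ʳ_)) ⟨
      sum (λ i → A i (σ ⟨$⟩ʳ i) + u i + v (σ ⟨$⟩ʳ i))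
        ≡⟨ sum-cong-≗ slack-tight ⟩
      sum {n} (λ _ → 0ℝ)
        ≡⟨ sum-replicate-zero n ⟩
      0ℝ ∎)

  symmetric-dual : ∀ {n} (A : Matrix R n) {σ u v} → Symmetric R A → IsAssignmentDual A σ u v →
                   Σ (Fin n → ℝ) λ w → IsAssignmentDual A σ w w
  symmetric-dual {n} A {σ} {u} {v} A-sym dual@(isAssignmentDual slack-nonneg slack-tight) =
    w , isAssignmentDual entry-nonneg entry-tight
    where
    slack : Fin n → Fin n → ℝ
    slack r k = A r k + u r + v k
    w : Fin n → ℝ
    w i = (u i + v i) * ½
    entry≡ : ∀ k l → A k l + w k + w l ≡ (slack k l + slack l k) * ½
    entry≡ k l = trans (x+[y+z]*½+[y′+z′]*½ (A k l) (u k) (v k) (u l) (v l))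
      (cong (λ a → (slack k l + (a + u l + v k)) * ½) (A-sym k l))
    entry-nonneg : ∀ k l → 0ℝ ≤ A k l + w k + w l
    entry-nonneg k l = subst (0ℝ ≤_) (sym (entry≡ k l))
      (*-nonneg _ _ (+-nonneg (slack-nonneg k l) (slack-nonneg l k)) 0≤½)
    entry-tight : ∀ i → A i (σ ⟨$⟩ʳ i) + w i + w (σ ⟨$⟩ʳ i) ≡ 0ℝ
    entry-tight i = begin
      A i (σ ⟨$⟩ʳ i) + w i + w (σ ⟨$⟩ʳ i)           ≡⟨ entry≡ i (σ ⟨$⟩ʳ i) ⟩
      (slack i (σ ⟨$⟩ʳ i) + slack (σ ⟨$⟩ʳ i) i) * ½
        ≡⟨ cong₂ (λ a b → (a + b) * ½) (slack-tight i) (reverse-slack-tight A A-sym dual i) ⟩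
      (0ℝ + 0ℝ) * ½                                  ≡⟨ cong (_* ½) (+-identityʳ 0ℝ) ⟩
      0ℝ * ½                                         ≡⟨ zeroˡ ½ ⟩
      0ℝ                                             ∎

  indicator-self : ∀ {n} (i : Fin n) a → indicator R i a i ≡ a
  indicator-self i a with i ≟ i
  ... | yes _   = refl
  ... | no i≢i = contradiction refl i≢i

  indicator-other : ∀ {n} {i k : Fin n} a → k ≢ i → indicator R i a k ≡ 0ℝ
  indicator-other {i = i} {k} a k≢i with k ≟ i
  ... | yes k≡i = contradiction k≡i k≢i
  ... | no _    = refl

  shift : ∀ {n} → List (Fin n × ℝ) → Fin n → ℝ
  shift []              k = 0ℝ
  shift ((i , a) ∷ ops) k = indicator R i a k + shift ops k

  applyScalings-shift : ∀ {n} ops (B : Matrix R n) k l →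
                        applyScalings R ops B k l ≡ B k l + shift ops k + shift ops l
  applyScalings-shift []              B k l =
    sym (trans (cong (_+ 0ℝ) (+-identityʳ (B k l))) (+-identityʳ (B k l)))
  applyScalings-shift ((i , a) ∷ ops) B k l = trans (applyScalings-shift ops (symScale R i a B) k l)
    (+-solve 5 (λ b p q s t → (((b ⊕ p) ⊕ q) ⊕ s) ⊕ t ⊜ (b ⊕ (p ⊕ s)) ⊕ (q ⊕ t)) refl _ _ _ _ _)

  scalings : ∀ {n} → (Fin n → ℝ) → List (Fin n × ℝ)
  scalings w = tabulate (λ i → i , w i)

  shift-tabulate : ∀ {m n} (f : Fin m → Fin n) (w : Fin m → ℝ) k →
                   shift (tabulate (λ i → f i , w i)) k ≡ sum (λ i → indicator R (f i) (w i) k)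
  shift-tabulate {zero}  f w k = refl
  shift-tabulate {suc m} f w k =
    cong (indicator R (f zero) (w zero) k +_) (shift-tabulate (f ∘ suc) (w ∘ suc) k)

  shift-scalings : ∀ {n} (w : Fin n → ℝ) k → shift (scalings w) k ≡ w k
  shift-scalings w k = begin
    shift (scalings w) k               ≡⟨ shift-tabulate (λ i → i) w k ⟩
    sum (λ i → indicator R i (w i) k)  ≡⟨ sum-single k (λ i i≢k → indicator-other (w i) (i≢k ∘ sym)) ⟩
    indicator R k (w k) k              ≡⟨ indicator-self k (w k) ⟩
    w k                                ∎

  applyScalings-scalings : ∀ {n} (w : Fin n → ℝ) (B : Matrix R n) k l →
                           applyScalings R (scalings w) B k l ≡ B k l + w k + w l
  applyScalings-scalings w B k l = trans (applyScalings-shift (scalings w) B k l)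
    (cong₂ (λ a b → B k l + a + b) (shift-scalings w k) (shift-scalings w l))

  symmetric-normal-form : ∀ {n} (A : Matrix R n) → Symmetric R A → ∀ σ → RealizesTropDet R A σ →
    Σ (List (Fin n × ℝ)) λ ops →
      (∀ k l → 0ℝ ≤ applyScalings R ops A k l) × (∀ i → applyScalings R ops A i (σ ⟨$⟩ʳ i) ≡ 0ℝ)
  symmetric-normal-form A A-sym σ σ-optimal
    with u , v , dual ← assignment-dual A σ σ-optimal
    with w , isAssignmentDual entry-nonneg entry-tight ← symmetric-dual A A-sym dual =
    scalings w ,
    (λ k l → subst (0ℝ ≤_) (sym (applyScalings-scalings w A k l)) (entry-nonneg k l)) ,
    (λ i → trans (applyScalings-scalings w A i (σ ⟨$⟩ʳ i)) (entry-tight i))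

proposition1 : (R : RealNumbers) → (A : Matrix R 5) → Symmetric R A →
    (σ : Permutation′ 5) → RealizesTropDet R A σ →
    Σ (Permutation′ 5) λ π → Σ (List (Fin 5 × RealNumbers.ℝ R)) λ ops →
      (∀ k l → RealNumbers._≤_ R (RealNumbers.0ℝ R) (applyScalings R ops (diagPerm R π A) k l))
      × (∀ i → applyScalings R ops (diagPerm R π A) (π ⟨$⟩ʳ i) (π ⟨$⟩ʳ (σ ⟨$⟩ʳ i)) ≡ RealNumbers.0ℝ R)
proposition1 R A A-sym σ σ-optimal = idₚ , symmetric-normal-form R A A-sym σ σ-optimal
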